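{- Let $G$ be a finite simple undirected graph, let $\mathcal{M}_1,\mathcal{M}_2$ be MCBs of $G$, and let $\mathcal{PI}\subseteq\mathcal{C}_{\mathcal{R}}$ be an equivalence class of the relation $\sim_{\mathtt{pi}}$. Then $|\mathcal{M}_1\cap\mathcal{PI}|=|\mathcal{M}_2\cap\mathcal{PI}|$.
   Context: Let $G=(V,E)$ be a finite simple undirected graph. A cycle is a set $C\subseteq E$ such that every vertex of $G$ has even degree in the subgraph with edge set $C$; $|C|$ denotes the number of edges. The cycles form a vector space over $GF(2)$ under symmetric difference. A minimum cycle basis (MCB) is a basis $\mathcal{M}$ of this space minimizing $\sum_{B\in\mathcal{M}}|B|$. The set of relevant cycles $\mathcal{C}_{\mathcal{R}}$ is the union of all MCBs. For $C_1,C_2\in\mathcal{C}_{\mathcal{R}}$, $C_1\sim_{\mathtt{pi}}C_2$ means there exists an MCB $\mathcal{M}_2$ with $C_2\in\mathcal{M}_2$ such that $(\mathcal{M}_2\setminus\{C_2\})\cup\{C_1\}$ is also an MCB; this is an equivalence relation on $\mathcal{C}_{\mathcal{R}}$, whose classes are called pi classes. -}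

module Defs where

open import Data.Nat using (ℕ; zero; suc; _≤_; _*_)
open import Data.Bool using (Bool; true; false; _∨_; _xor_)
open import Data.Fin using (Fin; zero; suc; _≟_)
open import Data.Fin.Subset using (Subset; ⊥; _∩_; ∣_∣)
open import Data.Vec using (Vec; tabulate; zipWith; []; _∷_)
open import Data.List using (List; []; _∷_; length; map; lookup; _[_]∷=_)
open import Data.Nat.ListAction using (sum)
open import Data.List.Membership.Propositional using (_∈_)
open import Data.Product using (Σ; ∃; ∃-syntax; _×_; proj₁; proj₂; _,_)
open import Data.Sum using (_⊎_)
open import Relation.Binary.PropositionalEquality using (_≡_; _≢_)
open import Relation.Nullary.Decidable using (⌊_⌋)
open import Relation.Nullary using (¬_)

record Graph : Set where
  field
    n        : ℕ
    m        : ℕ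
    ends     : Fin m → Fin n × Fin n
    loopless : ∀ e → proj₁ (ends e) ≢ proj₂ (ends e)
    simple   : ∀ e f →
      ((proj₁ (ends e) ≡ proj₁ (ends f)) × (proj₂ (ends e) ≡ proj₂ (ends f)))
      ⊎ ((proj₁ (ends e) ≡ proj₂ (ends f)) × (proj₂ (ends e) ≡ proj₁ (ends f)))
      → e ≡ f

module _ (G : Graph) where
  open Graph G

  EdgeSet : Set
  EdgeSet = Subset m

  incident : Fin n → EdgeSet
  incident v = tabulate (λ e → ⌊ v ≟ proj₁ (ends e) ⌋ ∨ ⌊ v ≟ proj₂ (ends e) ⌋)

  degIn : EdgeSet → Fin n → ℕ
  degIn C v = ∣ C ∩ incident v ∣

  Even : ℕ → Set
  Even d = ∃[ k ] d ≡ 2 * k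

  IsCycle : EdgeSet → Set
  IsCycle C = ∀ v → Even (degIn C v)

  _⊕_ : EdgeSet → EdgeSet → EdgeSet
  _⊕_ = zipWith _xor_

  combo : (M : List EdgeSet) → (Fin (length M) → Bool) → EdgeSet
  combo []      c = ⊥
  combo (B ∷ M) c with c zero
  ... | true  = B ⊕ combo M (λ i → c (suc i))
  ... | false = combo M (λ i → c (suc i))

  LinIndep : List EdgeSet → Set
  LinIndep M = ∀ c → combo M c ≡ ⊥ → ∀ i → c i ≡ false

  IsCycleBasis : List EdgeSet → Set
  IsCycleBasis M =
    (∀ i → IsCycle (lookup M i)) × LinIndep M ×
    (∀ C → IsCycle C → ∃[ c ] combo M c ≡ C)

  weight : List EdgeSet → ℕ
  weight M = sum (map ∣_∣ M)

  IsMCB : List EdgeSet → Set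
  IsMCB M = IsCycleBasis M × (∀ M′ → IsCycleBasis M′ → weight M ≤ weight M′)

  Relevant : EdgeSet → Set
  Relevant C = ∃[ M ] IsMCB M × C ∈ M

  _∼pi_ : EdgeSet → EdgeSet → Set
  C₁ ∼pi C₂ = ∃[ M₂ ] Σ (Fin (length M₂)) λ i →
    IsMCB M₂ × lookup M₂ i ≡ C₂ × IsMCB (M₂ [ i ]∷= C₁)

  IsPiClass : (EdgeSet → Set) → Set
  IsPiClass P = ∃[ C₀ ] Relevant C₀ ×
    (∀ C → (P C → Relevant C × C ∼pi C₀) × (Relevant C × C ∼pi C₀ → P C))

data CountIn {A : Set} (P : A → Set) : List A → ℕ → Set where
  nil  : CountIn P [] 0
  yes  : ∀ {x xs k} → P x       → CountIn P xs k → CountIn P (x ∷ xs) (suc k)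
  no   : ∀ {x xs k} → ¬ P x → CountIn P xs k → CountIn P (x ∷ xs) k

{-# OPTIONS --safe #-}
module Submission where

-- Any two minimum bases are connected by a sequence of exchanges, each replacing one basis element C
-- by a vector C′ with |C′| = |C| (trade an element of M₁ that is not in M₂ for an element of M₂ in
-- its fundamental circuit), followed by a permutation. Such an exchange witnesses both C′ ∼pi C and
-- C ∼pi C′, so once ∼pi is known to be transitive it preserves membership in every pi class, and the
-- number of basis elements in a pi class is the same for all minimum bases.
--
-- Transitivity is the heart of the matter. Call u and v linked through a minimum basis D at p when
-- both expansions in D use D_p and |u| = |v| = |D_p|; then u ∼pi v iff u and v are linked through
-- some minimum basis. A link through D′ = D [ a ]≔ t is a chain of at most two links through D, so a
-- link through one minimum basis is a chain of links through any other one. Finally a chain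
-- x –a– y –q– … through D can be shortened: either x already uses D_q, or a later vertex uses D_a,
-- or exchanging D_a for y links x to the rest of the chain through D_q.

open import Algebra.Bundles using (CommutativeMonoid)
import Algebra.Properties.CommutativeSemigroup as CommutativeSemigroupProperties
open import Data.Bool using (Bool; true; false; _xor_; _∧_)
import Data.Bool as Bool
open import Data.Bool.Properties
  using (xor-same; xor-assoc; xor-comm; xor-identityˡ; xor-identityʳ; ∧-zeroʳ; ∧-conicalˡ; ∧-conicalʳ)
open import Data.Empty using (⊥-elim)
open import Data.Fin using (Fin; toℕ; fromℕ<) renaming (zero to fzero; suc to fsuc)
open import Data.Fin.Properties using (toℕ<n; toℕ-fromℕ<)
open import Data.Fin.Subset using (Subset; ∣_∣) renaming (⊥ to ∅)
open import Data.List using (List; []; _∷_; length; map; lookup; _[_]∷=_)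
open import Data.List.Membership.Propositional using (_∈_; _∉_)
import Data.List.Membership.DecPropositional as DecMembership
open import Data.List.Membership.Propositional.Properties.WithK using (unique∧set⇒bag)
open import Data.List.Relation.Binary.BagAndSetEquality using (∼bag⇒↭)
open import Data.List.Relation.Binary.Permutation.Propositional
  using (_↭_; ↭-sym) renaming (refl to ↭-refl; prep to ↭-prep; swap to ↭-swap; trans to ↭-trans)
open import Data.List.Relation.Binary.Permutation.Propositional.Properties using (∈-resp-↭)
open import Data.List.Relation.Binary.Subset.Propositional using (_⊆_)
open import Data.List.Relation.Unary.All using (All; []; _∷_)
import Data.List.Relation.Unary.All as All
open import Data.List.Relation.Unary.All.Properties using (¬Any⇒All¬)
open import Data.List.Relation.Unary.AllPairs using ([]; _∷_)
open import Data.List.Relation.Unary.Any using (here; there)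
import Data.List.Relation.Unary.Any as Any
open import Data.List.Relation.Unary.Any.Properties using (lookup-index)
open import Data.List.Relation.Unary.Unique.Propositional using (Unique)
open import Data.Nat using (ℕ; zero; suc; _+_; _≤_; _<_; s≤s; z<s; s<s; _≟_)
open import Data.Nat.ListAction using (sum)
open import Data.Nat.Properties
  using ( suc-injective; +-assoc; +-commutativeSemigroup; +-cancelˡ-≡; +-cancelʳ-≡; +-cancelˡ-≤; +-monoˡ-≤
        ; ≤-refl; ≤-trans; ≤-antisym; m≤n⇒m≤1+n; module ≤-Reasoning)
open import Data.Product using (Σ-syntax; ∃-syntax; _×_; _,_; proj₁; proj₂; map₂)
open import Data.Sum using (_⊎_; inj₁; inj₂)
open import Data.Vec using ([]; _∷_; zipWith)
open import Data.Vec.Properties using (zipWith-assoc; zipWith-comm; zipWith-identityˡ; zipWith-identityʳ; ≡-dec)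
open import Function using (id; _∘_)
open import Function.Bundles using (_⇔_; mk⇔; Equivalence)
open import Level using (0ℓ)
open import Relation.Binary.Construct.Closure.ReflexiveTransitive using (Star; ε; _◅_; _⋆; reverse)
import Relation.Binary.Construct.Closure.ReflexiveTransitive as Star
open import Relation.Binary.PropositionalEquality
  using (_≡_; _≢_; refl; sym; trans; cong; cong₂; subst; isEquivalence; module ≡-Reasoning)
open import Relation.Nullary.Decidable using (yes; no; does; dec-true; dec-false)
open import Relation.Nullary.Negation using (contradiction)

open import Defs
  using (Graph; EdgeSet; IsCycle; combo; IsCycleBasis; IsMCB; Relevant; _∼pi_; IsPiClass; CountIn; nil)
  renaming (yes to yesᶜ; no to noᶜ)

private variable
  n : ℕ
  Elem : Set

infixl 6 _⊕_
infixr 7 _·_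

_⊕_ : Subset n → Subset n → Subset n
_⊕_ = zipWith _xor_

_·_ : Bool → Subset n → Subset n
true  · x = x
false · x = ∅

⊕-commutativeMonoid : ℕ → CommutativeMonoid 0ℓ 0ℓ
⊕-commutativeMonoid n = record
  { Carrier             = Subset n
  ; _≈_                 = _≡_
  ; _∙_                 = _⊕_
  ; ε                   = ∅
  ; isCommutativeMonoid = record
    { isMonoid = record
      { isSemigroup = record
        { isMagma = record { isEquivalence = isEquivalence ; ∙-cong = cong₂ _⊕_ }
        ; assoc   = zipWith-assoc xor-assoc
        }
      ; identity = zipWith-identityˡ xor-identityˡ , zipWith-identityʳ xor-identityʳ
      }
    ; comm = zipWith-comm xor-comm
    }
  }

module _ {n : ℕ} where
  open CommutativeMonoid (⊕-commutativeMonoid n) public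
    using () renaming (assoc to ⊕-assoc; comm to ⊕-comm; identityˡ to ⊕-identityˡ; identityʳ to ⊕-identityʳ)
  open CommutativeSemigroupProperties (CommutativeMonoid.commutativeSemigroup (⊕-commutativeMonoid n)) public
    using () renaming (interchange to ⊕-interchange)

⊕-self : (x : Subset n) → x ⊕ x ≡ ∅
⊕-self []      = refl
⊕-self (b ∷ x) = cong₂ _∷_ (xor-same b) (⊕-self x)

⊕-cancelʳ : (x y : Subset n) → (x ⊕ y) ⊕ y ≡ x
⊕-cancelʳ x y = begin
  (x ⊕ y) ⊕ y  ≡⟨ ⊕-assoc x y y ⟩
  x ⊕ (y ⊕ y)  ≡⟨ cong (x ⊕_) (⊕-self y) ⟩
  x ⊕ ∅        ≡⟨ ⊕-identityʳ x ⟩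
  x            ∎
  where open ≡-Reasoning

xor≡false⇒≡ : ∀ a b → a xor b ≡ false → a ≡ b
xor≡false⇒≡ false false _ = refl
xor≡false⇒≡ true  true  _ = refl

·-distribʳ-xor : ∀ a b (x : Subset n) → (a xor b) · x ≡ a · x ⊕ b · x
·-distribʳ-xor false false x = sym (⊕-identityˡ ∅)
·-distribʳ-xor false true  x = sym (⊕-identityˡ x)
·-distribʳ-xor true  false x = sym (⊕-identityʳ x)
·-distribʳ-xor true  true  x = sym (⊕-self x)

·-replace : ∀ b (x v L : Subset n) → b · v ⊕ L ≡ (b · x ⊕ L) ⊕ b · (x ⊕ v)
·-replace false x v L = sym (⊕-identityʳ _)
·-replace true  x v L = begin
  v ⊕ L              ≡⟨ ⊕-comm v L ⟩
  L ⊕ v              ≡⟨ ⊕-identityˡ _ ⟨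
  ∅ ⊕ (L ⊕ v)        ≡⟨ cong (_⊕ (L ⊕ v)) (⊕-self x) ⟨
  (x ⊕ x) ⊕ (L ⊕ v)  ≡⟨ ⊕-interchange x x L v ⟩
  (x ⊕ L) ⊕ (x ⊕ v)  ∎
  where open ≡-Reasoning

-- Positions (and below, coordinates) are indexed by ℕ rather than Fin (length M), so that they
-- survive replacing an entry of M; out of range, `at` returns the junk value ∅.
at : List (Subset n) → ℕ → Subset n
at []      _       = ∅
at (x ∷ M) zero    = x
at (x ∷ M) (suc k) = at M k

_[_]≔_ : List Elem → ℕ → Elem → List Elem
[]      [ _     ]≔ _ = []
(x ∷ M) [ zero  ]≔ v = v ∷ M
(x ∷ M) [ suc p ]≔ v = x ∷ (M [ p ]≔ v)

length-≔ : (M : List Elem) (p : ℕ) (v : Elem) → length (M [ p ]≔ v) ≡ length M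
length-≔ []      p       v = refl
length-≔ (x ∷ M) zero    v = refl
length-≔ (x ∷ M) (suc p) v = cong suc (length-≔ M p v)

≔-≔ : (M : List Elem) (p : ℕ) (v v′ : Elem) → (M [ p ]≔ v) [ p ]≔ v′ ≡ M [ p ]≔ v′
≔-≔ []      p       v v′ = refl
≔-≔ (x ∷ M) zero    v v′ = refl
≔-≔ (x ∷ M) (suc p) v v′ = cong (x ∷_) (≔-≔ M p v v′)

≔-revert : (M : List (Subset n)) (p : ℕ) (v : Subset n) → (M [ p ]≔ v) [ p ]≔ at M p ≡ M
≔-revert []      p       v = refl
≔-revert (x ∷ M) zero    v = refl
≔-revert (x ∷ M) (suc p) v = cong (x ∷_) (≔-revert M p v)

at-≔-same : (M : List (Subset n)) {p : ℕ} (v : Subset n) → p < length M → at (M [ p ]≔ v) p ≡ v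
at-≔-same (x ∷ M) {zero}  v _        = refl
at-≔-same (x ∷ M) {suc p} v (s<s p<) = at-≔-same M v p<

at-≔-other : (M : List (Subset n)) {p q : ℕ} (v : Subset n) → q ≢ p → at (M [ p ]≔ v) q ≡ at M q
at-≔-other []      v q≢p = refl
at-≔-other (x ∷ M) {zero}  {zero}  v q≢p = ⊥-elim (q≢p refl)
at-≔-other (x ∷ M) {zero}  {suc q} v q≢p = refl
at-≔-other (x ∷ M) {suc p} {zero}  v q≢p = refl
at-≔-other (x ∷ M) {suc p} {suc q} v q≢p = at-≔-other M v (q≢p ∘ cong suc)

at-∈ : (M : List (Subset n)) {k : ℕ} → k < length M → at M k ∈ M
at-∈ (x ∷ M) {zero}  _        = here refl
at-∈ (x ∷ M) {suc k} (s<s k<) = there (at-∈ M k<)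

∈⇒at : {x : Subset n} (M : List (Subset n)) → x ∈ M → ∃[ k ] k < length M × at M k ≡ x
∈⇒at (y ∷ M) (here x≡y) = zero , z<s , sym x≡y
∈⇒at (y ∷ M) (there x∈M) with ∈⇒at M x∈M
... | k , k< , Mk≡x = suc k , s<s k< , Mk≡x

at-injective⇒unique : (M : List (Subset n)) →
  (∀ {i j} → i < length M → j < length M → at M i ≡ at M j → i ≡ j) → Unique M
at-injective⇒unique []      _   = []
at-injective⇒unique (x ∷ M) inj =
  ¬Any⇒All¬ M x∉M ∷ at-injective⇒unique M (λ i< j< → suc-injective ∘ inj (s<s i<) (s<s j<))
  where
  x∉M : x ∉ M
  x∉M x∈M with ∈⇒at M x∈M
  ... | j , j< , Mj≡x with () ← inj z<s (s<s j<) (sym Mj≡x)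

All-at : {P : Subset n → Set} {M : List (Subset n)} {k : ℕ} → All P M → k < length M → P (at M k)
All-at {k = zero}  (px ∷ _)   _        = px
All-at {k = suc k} (_  ∷ pxs) (s<s k<) = All-at pxs k<

All-≔ : {P : Elem → Set} {M : List Elem} (p : ℕ) {v : Elem} → All P M → P v → All P (M [ p ]≔ v)
All-≔ p       []         pv = []
All-≔ zero    (_  ∷ pxs) pv = pv ∷ pxs
All-≔ (suc p) (px ∷ pxs) pv = px ∷ All-≔ p pxs pv

countIn-≔ : {P : Subset n → Set} {i k : ℕ} {t : Subset n} (A : List (Subset n)) → i < length A →
  P (at A i) ⇔ P t → CountIn P A k → CountIn P (A [ i ]≔ t) k
countIn-≔ {i = zero}  (x ∷ A) _        Px⇔Pt (yesᶜ px c) = yesᶜ (Equivalence.to Px⇔Pt px) c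
countIn-≔ {i = zero}  (x ∷ A) _        Px⇔Pt (noᶜ ¬px c) = noᶜ (¬px ∘ Equivalence.from Px⇔Pt) c
countIn-≔ {i = suc i} (x ∷ A) (s<s i<) Pi⇔Pt (yesᶜ px c) = yesᶜ px (countIn-≔ A i< Pi⇔Pt c)
countIn-≔ {i = suc i} (x ∷ A) (s<s i<) Pi⇔Pt (noᶜ ¬px c) = noᶜ ¬px (countIn-≔ A i< Pi⇔Pt c)

countIn-↭ : {P : Elem → Set} {xs ys : List Elem} {k : ℕ} → xs ↭ ys → CountIn P xs k → CountIn P ys k
countIn-↭ ↭-refl                c                     = c
countIn-↭ (↭-prep x xs↭ys)      (yesᶜ px c)           = yesᶜ px (countIn-↭ xs↭ys c)
countIn-↭ (↭-prep x xs↭ys)      (noᶜ ¬px c)           = noᶜ ¬px (countIn-↭ xs↭ys c)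
countIn-↭ (↭-swap x y xs↭ys)    (yesᶜ px (yesᶜ py c)) = yesᶜ py (yesᶜ px (countIn-↭ xs↭ys c))
countIn-↭ (↭-swap x y xs↭ys)    (yesᶜ px (noᶜ ¬py c)) = noᶜ ¬py (yesᶜ px (countIn-↭ xs↭ys c))
countIn-↭ (↭-swap x y xs↭ys)    (noᶜ ¬px (yesᶜ py c)) = yesᶜ py (noᶜ ¬px (countIn-↭ xs↭ys c))
countIn-↭ (↭-swap x y xs↭ys)    (noᶜ ¬px (noᶜ ¬py c)) = noᶜ ¬py (noᶜ ¬px (countIn-↭ xs↭ys c))
countIn-↭ (↭-trans xs↭ys ys↭zs) c                     = countIn-↭ ys↭zs (countIn-↭ xs↭ys c)

countIn-functional : {P : Elem → Set} {xs : List Elem} {k k′ : ℕ} →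
  CountIn P xs k → CountIn P xs k′ → k ≡ k′
countIn-functional nil         nil         = refl
countIn-functional (yesᶜ _ c)  (yesᶜ _ c′) = cong suc (countIn-functional c c′)
countIn-functional (yesᶜ px _) (noᶜ ¬px _) = contradiction px ¬px
countIn-functional (noᶜ ¬px _) (yesᶜ px _) = contradiction px ¬px
countIn-functional (noᶜ _ c)   (noᶜ _ c′)  = countIn-functional c c′

lincomb : List (Subset n) → (ℕ → Bool) → Subset n
lincomb []      c = ∅
lincomb (x ∷ M) c = c 0 · x ⊕ lincomb M (c ∘ suc)

lincomb-false : (M : List (Subset n)) → lincomb M (λ _ → false) ≡ ∅
lincomb-false []      = refl
lincomb-false (x ∷ M) = trans (⊕-identityˡ _) (lincomb-false M)

lincomb-xor : (M : List (Subset n)) (c d : ℕ → Bool) →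
  lincomb M (λ k → c k xor d k) ≡ lincomb M c ⊕ lincomb M d
lincomb-xor []      c d = sym (⊕-identityˡ ∅)
lincomb-xor (x ∷ M) c d = begin
  (c 0 xor d 0) · x ⊕ lincomb M (λ k → c (suc k) xor d (suc k))
    ≡⟨ cong₂ _⊕_ (·-distribʳ-xor (c 0) (d 0) x) (lincomb-xor M (c ∘ suc) (d ∘ suc)) ⟩
  (c 0 · x ⊕ d 0 · x) ⊕ (lincomb M (c ∘ suc) ⊕ lincomb M (d ∘ suc))
    ≡⟨ ⊕-interchange _ _ _ _ ⟩
  (c 0 · x ⊕ lincomb M (c ∘ suc)) ⊕ (d 0 · x ⊕ lincomb M (d ∘ suc))
    ∎
  where open ≡-Reasoning

lincomb-∧ : (M : List (Subset n)) (b : Bool) (c : ℕ → Bool) → lincomb M (λ k → b ∧ c k) ≡ b · lincomb M c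
lincomb-∧ M false c = lincomb-false M
lincomb-∧ M true  c = refl

δ : ℕ → ℕ → Bool
δ p k = does (p ≟ k)

δ-refl : (p : ℕ) → δ p p ≡ true
δ-refl p = dec-true (p ≟ p) refl

δ-≢ : {p k : ℕ} → p ≢ k → δ p k ≡ false
δ-≢ {p} {k} = dec-false (p ≟ k)

δ-true : {p k : ℕ} → δ p k ≡ true → p ≡ k
δ-true {p} {k} δ≡true with p ≟ k
... | yes p≡k = p≡k
... | no  p≢k with () ← trans (sym (δ-≢ p≢k)) δ≡true

lincomb-δ : (M : List (Subset n)) (p : ℕ) → lincomb M (δ p) ≡ at M p
lincomb-δ []      p       = refl
lincomb-δ (x ∷ M) zero    = trans (cong (x ⊕_) (lincomb-false M)) (⊕-identityʳ x)
lincomb-δ (x ∷ M) (suc p) = trans (⊕-identityˡ _) (lincomb-δ M p)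

lincomb-≔ : (M : List (Subset n)) {p : ℕ} (v : Subset n) (c : ℕ → Bool) → p < length M →
  lincomb (M [ p ]≔ v) c ≡ lincomb M c ⊕ c p · (at M p ⊕ v)
lincomb-≔ (x ∷ M) {zero}  v c _        = ·-replace (c 0) x v (lincomb M (c ∘ suc))
lincomb-≔ (x ∷ M) {suc p} v c (s<s p<) = begin
  c 0 · x ⊕ lincomb (M [ p ]≔ v) (c ∘ suc)
    ≡⟨ cong (c 0 · x ⊕_) (lincomb-≔ M v (c ∘ suc) p<) ⟩
  c 0 · x ⊕ (lincomb M (c ∘ suc) ⊕ c (suc p) · (at M p ⊕ v))
    ≡⟨ ⊕-assoc _ _ _ ⟨
  (c 0 · x ⊕ lincomb M (c ∘ suc)) ⊕ c (suc p) · (at M p ⊕ v)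
    ∎
  where open ≡-Reasoning

-- If lincomb M ct ≡ t and ct p ≡ true, then at M p = t ⊕ Σ_{k ≢ p} ct k · at M k; substituting this
-- shows that rebase ct p c are coordinates of lincomb M c with respect to M [ p ]≔ t.
rebase : (ℕ → Bool) → ℕ → (ℕ → Bool) → ℕ → Bool
rebase ct p c k = c k xor (c p ∧ (ct k xor δ p k))

rebase-at : (ct : ℕ → Bool) {p : ℕ} (c : ℕ → Bool) → ct p ≡ true → rebase ct p c p ≡ c p
rebase-at ct {p} c ctp rewrite ctp | δ-refl p | ∧-zeroʳ (c p) = xor-identityʳ (c p)

rebase-avoiding : (ct : ℕ → Bool) {p : ℕ} (c : ℕ → Bool) (k : ℕ) → c p ≡ false → rebase ct p c k ≡ c k
rebase-avoiding ct c k cp rewrite cp = xor-identityʳ (c k)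

rebase-other : (ct : ℕ → Bool) {p k : ℕ} (c : ℕ → Bool) → k ≢ p → rebase ct p c k ≡ c k xor (c p ∧ ct k)
rebase-other ct {p} {k} c k≢p rewrite δ-≢ (k≢p ∘ sym) = cong (λ b → c k xor (c p ∧ b)) (xor-identityʳ (ct k))

lincomb-rebase : (M : List (Subset n)) {p : ℕ} {t : Subset n} (ct c : ℕ → Bool) → lincomb M ct ≡ t →
  lincomb M (rebase ct p c) ≡ lincomb M c ⊕ c p · (at M p ⊕ t)
lincomb-rebase M {p} {t} ct c ct≡t = begin
  lincomb M (rebase ct p c)
    ≡⟨ lincomb-xor M c _ ⟩
  lincomb M c ⊕ lincomb M (λ k → c p ∧ (ct k xor δ p k))
    ≡⟨ cong (lincomb M c ⊕_) (lincomb-∧ M (c p) _) ⟩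
  lincomb M c ⊕ c p · lincomb M (λ k → ct k xor δ p k)
    ≡⟨ cong (λ y → lincomb M c ⊕ c p · y) (lincomb-xor M ct (δ p)) ⟩
  lincomb M c ⊕ c p · (lincomb M ct ⊕ lincomb M (δ p))
    ≡⟨ cong (λ y → lincomb M c ⊕ c p · y) (cong₂ _⊕_ ct≡t (lincomb-δ M p)) ⟩
  lincomb M c ⊕ c p · (t ⊕ at M p)
    ≡⟨ cong (λ y → lincomb M c ⊕ c p · y) (⊕-comm t (at M p)) ⟩
  lincomb M c ⊕ c p · (at M p ⊕ t)
    ∎
  where open ≡-Reasoning

lincomb-≔-rebase : (M : List (Subset n)) {p : ℕ} {t : Subset n} (ct c : ℕ → Bool) →
  p < length M → lincomb M ct ≡ t → ct p ≡ true → lincomb (M [ p ]≔ t) (rebase ct p c) ≡ lincomb M c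
lincomb-≔-rebase M {p} {t} ct c p< ct≡t ctp = begin
  lincomb (M [ p ]≔ t) (rebase ct p c)
    ≡⟨ lincomb-≔ M t (rebase ct p c) p< ⟩
  lincomb M (rebase ct p c) ⊕ rebase ct p c p · (at M p ⊕ t)
    ≡⟨ cong₂ _⊕_ (lincomb-rebase M ct c ct≡t) (cong (_· (at M p ⊕ t)) (rebase-at ct c ctp)) ⟩
  (lincomb M c ⊕ c p · (at M p ⊕ t)) ⊕ c p · (at M p ⊕ t)
    ≡⟨ ⊕-cancelʳ _ _ ⟩
  lincomb M c
    ∎
  where open ≡-Reasoning

lincomb-≔≡lincomb-rebase : (M : List (Subset n)) {p : ℕ} {t : Subset n} (ct d : ℕ → Bool) →
  p < length M → lincomb M ct ≡ t → lincomb (M [ p ]≔ t) d ≡ lincomb M (rebase ct p d)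
lincomb-≔≡lincomb-rebase M ct d p< ct≡t = trans (lincomb-≔ M _ d p<) (sym (lincomb-rebase M ct d ct≡t))

-- Bases

module Bases {n : ℕ} (S : Subset n → Set) where

  private variable
    M A B : List (Subset n)
    c d : ℕ → Bool
    p q k : ℕ
    t u x : Subset n

  record Independent (M : List (Subset n)) : Set where
    field
      only-trivial : ∀ c → lincomb M c ≡ ∅ → ∀ {k} → k < length M → c k ≡ false

  Spans : List (Subset n) → Set
  Spans M = ∀ {x} → S x → ∃[ c ] lincomb M c ≡ x

  record IsBasis (M : List (Subset n)) : Set where
    field
      members     : All S M
      independent : Independent M
      spans       : Spans M

  open IsBasis public

  record Through (M : List (Subset n)) (p : ℕ) (u : Subset n) : Set where
    constructor through
    field
      coords  : ℕ → Bool
      expands : lincomb M coords ≡ u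
      uses    : coords p ≡ true

  Avoids : List (Subset n) → ℕ → Subset n → Set
  Avoids M p u = ∀ {c} → lincomb M c ≡ u → c p ≡ false

  coords-unique : Independent M → lincomb M c ≡ lincomb M d → k < length M → c k ≡ d k
  coords-unique {M} {c} {d} {k} ind c≡d k< =
    xor≡false⇒≡ (c k) (d k) (Independent.only-trivial ind _ c⊕d≡∅ k<)
    where
    c⊕d≡∅ : lincomb M (λ j → c j xor d j) ≡ ∅
    c⊕d≡∅ = trans (lincomb-xor M c d) (trans (cong (_⊕ lincomb M d) c≡d) (⊕-self _))

  through-unique : Independent M → k < length M → Through M k u → lincomb M c ≡ u → c k ≡ true
  through-unique ind k< (through c′ c′≡u c′k) c≡u =
    trans (coords-unique ind (trans c≡u (sym c′≡u)) k<) c′k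

  avoids : Independent M → p < length M → lincomb M c ≡ u → c p ≡ false → Avoids M p u
  avoids ind p< c≡u cp c′≡u = trans (coords-unique ind (trans c′≡u (sym c≡u)) p<) cp

  through-at⇒≡ : Independent M → p < length M → Through M p (at M k) → k ≡ p
  through-at⇒≡ {M} {k = k} ind p< th = δ-true (through-unique ind p< th (lincomb-δ M k))

  at-injective : Independent M → p < length M → q < length M → at M p ≡ at M q → p ≡ q
  at-injective {M} {q = q} ind p< q< Mp≡Mq =
    through-at⇒≡ ind q< (through (δ q) (trans (lincomb-δ M q) (sym Mp≡Mq)) (δ-refl q))

  independent⇒unique : Independent M → Unique M
  independent⇒unique ind = at-injective⇒unique _ (at-injective ind)

  ∈-through⇒≡ : Independent M → p < length M → x ∈ M → Through M p x → x ≡ at M p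
  ∈-through⇒≡ {M} ind p< x∈M th with ∈⇒at M x∈M
  ... | k , _ , refl = cong (at M) (through-at⇒≡ ind p< th)

  private
    through-summand-there : ∀ {b} (d : ℕ → Bool) →
      ∃[ k ] k < length B × d (suc k) ≡ true × Through A p (at B k) →
      ∃[ k ] k < length (b ∷ B) × d k ≡ true × Through A p (at (b ∷ B) k)
    through-summand-there d (k , k< , dk , th) = suc k , s<s k< , dk , th

  through-summand : Independent A → Spans A → All S B → p < length A → (d : ℕ → Bool) →
    lincomb A c ≡ lincomb B d → c p ≡ true → ∃[ k ] k < length B × d k ≡ true × Through A p (at B k)
  through-summand ind spans [] p< d c≡∅ cp
    with () ← trans (sym cp) (Independent.only-trivial ind _ c≡∅ p<)
  through-summand {A} {B = b ∷ B} {p} {c} ind spans (sb ∷ sB) p< d c≡ cp with d 0 in d0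
  ... | false =
    through-summand-there d (through-summand ind spans sB p< (d ∘ suc) (trans c≡ (⊕-identityˡ _)) cp)
  ... | true with spans sb
  ...   | cb , cb≡b with cb p in cbp
  ...     | true  = zero , z<s , d0 , through cb cb≡b cbp
  ...     | false = through-summand-there d (through-summand ind spans sB p< (d ∘ suc) c⊕cb≡ c⊕cb-p)
    where
    c⊕cb≡ : lincomb A (λ k → c k xor cb k) ≡ lincomb B (d ∘ suc)
    c⊕cb≡ = begin
      lincomb A (λ k → c k xor cb k)  ≡⟨ lincomb-xor A c cb ⟩
      lincomb A c ⊕ lincomb A cb      ≡⟨ cong₂ _⊕_ c≡ cb≡b ⟩
      (b ⊕ lincomb B (d ∘ suc)) ⊕ b   ≡⟨ cong (_⊕ b) (⊕-comm b _) ⟩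
      (lincomb B (d ∘ suc) ⊕ b) ⊕ b   ≡⟨ ⊕-cancelʳ _ b ⟩
      lincomb B (d ∘ suc)             ∎
      where open ≡-Reasoning
    c⊕cb-p : c p xor cb p ≡ true
    c⊕cb-p rewrite cp | cbp = refl

  basis-⊆⇒⊇ : IsBasis A → IsBasis B → A ⊆ B → B ⊆ A
  basis-⊆⇒⊇ {A} {B} bA bB A⊆B x∈B with ∈⇒at B x∈B
  ... | j , j< , refl with spans bA (All-at (members bB) j<)
  ...   | c , c≡ with through-summand (independent bB) (spans bB) (members bA) j< c
                        (trans (lincomb-δ B j) (sym c≡)) (δ-refl j)
  ...     | k , k< , _ , th =
    subst (_∈ A) (∈-through⇒≡ (independent bB) j< (A⊆B (at-∈ A k<)) th) (at-∈ A k<)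

  through-⊆ : IsBasis A → IsBasis B → B ⊆ A → p < length A → q < length B → at A p ≡ at B q →
    S u → Through A p u → Through B q u
  through-⊆ {A} {B} {p} {q} bA bB B⊆A p< q< Ap≡Bq su (through c c≡ cp) with spans bB su
  ... | d , d≡ with through-summand (independent bA) (spans bA) (members bB) p< d (trans c≡ (sym d≡)) cp
  ...   | k , k< , dk , th = through d d≡ (subst (λ j → d j ≡ true) k≡q dk)
    where
    k≡q : k ≡ q
    k≡q = at-injective (independent bB) k< q<
            (trans (∈-through⇒≡ (independent bA) p< (B⊆A (at-∈ B k<)) th) Ap≡Bq)

  exchange-basis : IsBasis M → p < length M → S t → Through M p t → IsBasis (M [ p ]≔ t)
  exchange-basis {M} {p} {t} bM p< st (through ct ct≡t ctp) = record
    { members     = All-≔ p (members bM) st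
    ; independent = record { only-trivial = only-trivial }
    ; spans       = λ sx → let c , c≡ = spans bM sx in
                      rebase ct p c , trans (lincomb-≔-rebase M ct c p< ct≡t ctp) c≡
    }
    where
    only-trivial : ∀ d → lincomb (M [ p ]≔ t) d ≡ ∅ → ∀ {k} → k < length (M [ p ]≔ t) → d k ≡ false
    only-trivial d d≡∅ {k} k< = begin
      d k              ≡⟨ rebase-avoiding ct d k dp ⟨
      rebase ct p d k  ≡⟨ rebased-trivial (subst (k <_) (length-≔ M p t) k<) ⟩
      false            ∎
      where
      open ≡-Reasoning
      rebased-trivial : ∀ {j} → j < length M → rebase ct p d j ≡ false
      rebased-trivial = Independent.only-trivial (independent bM) _
                          (trans (sym (lincomb-≔≡lincomb-rebase M ct d p< ct≡t)) d≡∅)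
      dp : d p ≡ false
      dp = trans (sym (rebase-at ct d ctp)) (rebased-trivial p<)

  independent-≔⇒uses : Independent (M [ p ]≔ t) → p < length M → lincomb M c ≡ t → c p ≡ true
  independent-≔⇒uses {M} {p} {t} {c} ind p< c≡t with c p in cp
  ... | true  = refl
  ... | false = contradiction
    (trans (sym c′p) (Independent.only-trivial ind c′ c′≡∅ (subst (p <_) (sym (length-≔ M p t)) p<))) λ ()
    where
    c′ : ℕ → Bool
    c′ k = c k xor δ p k
    c′p : c′ p ≡ true
    c′p rewrite cp | δ-refl p = refl
    c′≡∅ : lincomb (M [ p ]≔ t) c′ ≡ ∅
    c′≡∅ = begin
      lincomb (M [ p ]≔ t) c′
        ≡⟨ lincomb-≔ M t c′ p< ⟩
      lincomb M c′ ⊕ c′ p · (at M p ⊕ t)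
        ≡⟨ cong₂ _⊕_ (lincomb-xor M c (δ p)) (cong (_· (at M p ⊕ t)) c′p) ⟩
      (lincomb M c ⊕ lincomb M (δ p)) ⊕ (at M p ⊕ t)
        ≡⟨ cong (_⊕ (at M p ⊕ t)) (cong₂ _⊕_ c≡t (lincomb-δ M p)) ⟩
      (t ⊕ at M p) ⊕ (at M p ⊕ t)
        ≡⟨ cong (_⊕ (at M p ⊕ t)) (⊕-comm t (at M p)) ⟩
      (at M p ⊕ t) ⊕ (at M p ⊕ t)
        ≡⟨ ⊕-self _ ⟩
      ∅
        ∎
      where open ≡-Reasoning

-- Minimum bases and exchanges

module MinimumBases {n : ℕ} (S : Subset n → Set) (w : Subset n → ℕ) where
  open Bases S public

  private variable
    A B C D M : List (Subset n)
    a i p q : ℕ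
    t u v x y z : Subset n
    c : ℕ → Bool

  weight : List (Subset n) → ℕ
  weight M = sum (map w M)

  weight-≔ : (M : List (Subset n)) (v : Subset n) → p < length M →
    weight (M [ p ]≔ v) + w (at M p) ≡ weight M + w v
  weight-≔ {p = zero}  (x ∷ M) v _        = xy∙z≈zy∙x (w v) (weight M) (w x)
    where open CommutativeSemigroupProperties +-commutativeSemigroup
  weight-≔ {p = suc p} (x ∷ M) v (s<s p<) = begin
    (w x + weight (M [ p ]≔ v)) + w (at M p)  ≡⟨ +-assoc (w x) _ _ ⟩
    w x + (weight (M [ p ]≔ v) + w (at M p))  ≡⟨ cong (w x +_) (weight-≔ M v p<) ⟩
    w x + (weight M + w v)                    ≡⟨ +-assoc (w x) _ _ ⟨
    (w x + weight M) + w v                    ∎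
    where open ≡-Reasoning

  record IsMinBasis (M : List (Subset n)) : Set where
    field
      basis   : IsBasis M
      minimal : ∀ {M′} → IsBasis M′ → weight M ≤ weight M′

  open IsMinBasis public

  min-through-≤ : IsMinBasis M → p < length M → S v → Through M p v → w (at M p) ≤ w v
  min-through-≤ {M} {p} {v} mM p< sv th = +-cancelˡ-≤ (weight M) _ _ (begin
    weight M + w (at M p)             ≤⟨ +-monoˡ-≤ _ (minimal mM (exchange-basis (basis mM) p< sv th)) ⟩
    weight (M [ p ]≔ v) + w (at M p)  ≡⟨ weight-≔ M v p< ⟩
    weight M + w v                    ∎)
    where open ≤-Reasoning

  record Attached (D : List (Subset n)) (p : ℕ) (u : Subset n) : Set where
    constructor attached
    field
      member    : S u
      expansion : Through D p u
      balanced  : w u ≡ w (at D p)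

    open Through expansion public

  open Attached public using (member; expansion; balanced)

  attached-self : IsBasis D → p < length D → Attached D p (at D p)
  attached-self {D} {p} bD p< = attached (All-at (members bD) p<) (through (δ p) (lincomb-δ D p) (δ-refl p)) refl

  attached-≔-min : IsMinBasis D → p < length D → Attached D p t → IsMinBasis (D [ p ]≔ t)
  attached-≔-min {D} {p} {t} mD p< (attached st th wt) = record
    { basis   = exchange-basis (basis mD) p< st th
    ; minimal = λ bM′ → subst (_≤ _) (sym same-weight) (minimal mD bM′)
    }
    where
    same-weight : weight (D [ p ]≔ t) ≡ weight D
    same-weight = +-cancelʳ-≡ (w (at D p)) _ _ (trans (weight-≔ D t p<) (cong (weight D +_) wt))

  record Exchange (A : List (Subset n)) (p : ℕ) (t : Subset n) : Set where
    field
      pos<   : p < length A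
      before : IsMinBasis A
      after  : IsMinBasis (A [ p ]≔ t)

  open Exchange public

  exchange-weight : Exchange A p t → w t ≡ w (at A p)
  exchange-weight {A} {p} {t} e = sym (+-cancelˡ-≡ (weight A) _ _ (begin
    weight A + w (at A p)             ≡⟨ cong (_+ w (at A p)) same-weight ⟨
    weight (A [ p ]≔ t) + w (at A p)  ≡⟨ weight-≔ A t (pos< e) ⟩
    weight A + w t                    ∎))
    where
    open ≡-Reasoning
    same-weight : weight (A [ p ]≔ t) ≡ weight A
    same-weight = ≤-antisym (minimal (after e) (basis (before e))) (minimal (before e) (basis (after e)))

  exchange-member : Exchange A p t → S t
  exchange-member {A} {p} {t} e = subst S (at-≔-same A t (pos< e))
    (All-at (members (basis (after e))) (subst (p <_) (sym (length-≔ A p t)) (pos< e)))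

  exchange-attached : Exchange A p t → Attached A p t
  exchange-attached e with spans (basis (before e)) (exchange-member e)
  ... | ct , ct≡t = attached (exchange-member e)
                      (through ct ct≡t (independent-≔⇒uses (independent (basis (after e))) (pos< e) ct≡t))
                      (exchange-weight e)

  attached-exchange : IsMinBasis A → p < length A → Attached A p t → Exchange A p t
  attached-exchange mA p< t-p = record { pos< = p< ; before = mA ; after = attached-≔-min mA p< t-p }

  exchange-sym : Exchange A p t → Exchange (A [ p ]≔ t) p (at A p)
  exchange-sym {A} {p} {t} e = record
    { pos<   = subst (p <_) (sym (length-≔ A p t)) (pos< e)
    ; before = after e
    ; after  = subst IsMinBasis (sym (≔-revert A p t)) (before e)
    }

  exchange-partner : IsMinBasis A → IsMinBasis B → i < length A → ∃[ k ] k < length B × Exchange A i (at B k)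
  exchange-partner {A} {B} {i} mA mB i< with spans (basis mB) (All-at (members (basis mA)) i<)
  ... | d , d≡ with through-summand (independent (basis mA)) (spans (basis mA)) (members (basis mB)) i< d
                      (trans (lincomb-δ A i) (sym d≡)) (δ-refl i)
  ...   | k , k< , dk , th = k , k< , attached-exchange mA i< (attached sBk th (≤-antisym Bk≤Ai Ai≤Bk))
    where
    sBk : S (at B k)
    sBk = All-at (members (basis mB)) k<
    Bk≤Ai : w (at B k) ≤ w (at A i)
    Bk≤Ai = min-through-≤ mB k< (All-at (members (basis mA)) i<) (through d d≡ dk)
    Ai≤Bk : w (at A i) ≤ w (at B k)
    Ai≤Bk = min-through-≤ mA i< sBk th

  Interchangeable : Subset n → Subset n → Set
  Interchangeable x y = ∃[ A ] ∃[ p ] Exchange A p x × at A p ≡ y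

  exchange-interchangeable : Exchange A p t → Interchangeable t (at A p) × Interchangeable (at A p) t
  exchange-interchangeable {A} {p} {t} e =
    (A , p , e , refl) , (A [ p ]≔ t , p , exchange-sym e , at-≔-same A t (pos< e))

  record Link (D : List (Subset n)) (u v : Subset n) : Set where
    constructor link
    field
      {pos} : ℕ
      pos<  : pos < length D
      left  : Attached D pos u
      right : Attached D pos v

  link-sym : Link D u v → Link D v u
  link-sym (link p< u-p v-p) = link p< v-p u-p

  link-weight : Link D u v → w u ≡ w v
  link-weight (link _ u-p v-p) = trans (balanced u-p) (sym (balanced v-p))

  Chain : List (Subset n) → Subset n → Subset n → Set
  Chain D = Star (Link D)

  chain-length : Chain D u v → ℕ
  chain-length ε        = 0
  chain-length (_ ◅ ch) = suc (chain-length ch)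

  interchangeable⇒link : Interchangeable x y → ∃[ A ] IsMinBasis A × Link A x y
  interchangeable⇒link (A , p , e , refl) =
    A , before e , link (pos< e) (exchange-attached e) (attached-self (basis (before e)) (pos< e))

  link⇒interchangeable : IsMinBasis D → Link D x y → Interchangeable x y
  link⇒interchangeable {D} {x} {y} mD (link {p} p< x-p y-p) = D [ p ]≔ y , p , e , at-≔-same D y p<
    where
    e : Exchange (D [ p ]≔ y) p x
    e = record
      { pos<   = subst (p <_) (sym (length-≔ D p y)) p<
      ; before = attached-≔-min mD p< y-p
      ; after  = subst IsMinBasis (sym (≔-≔ D p y x)) (attached-≔-min mD p< x-p)
      }

  attached-≔-avoiding : Independent D → a < length D → Through D a t → Avoids D a u →
    Attached D q u → Attached (D [ a ]≔ t) q u
  attached-≔-avoiding {D} {a} {t} {q = q} ind a< (through ct ct≡t cta) u-avoids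
                      (attached su (through c c≡u cq) wu) =
    attached su (through (rebase ct a c) (trans (lincomb-≔-rebase D ct c a< ct≡t cta) c≡u)
                         (trans (rebase-avoiding ct c q (u-avoids c≡u)) cq))
                (trans wu (cong w (sym (at-≔-other D t q≢a))))
    where
    q≢a : q ≢ a
    q≢a refl = contradiction (trans (sym cq) (u-avoids c≡u)) λ ()

  link-≔-avoiding : Independent D → a < length D → Through D a t → Avoids D a u → Avoids D a v →
    Link D u v → Link (D [ a ]≔ t) u v
  link-≔-avoiding {D} {t = t} ind a< th u-avoids v-avoids (link p< u-p v-p) =
    link (subst (_ <_) (sym (length-≔ D _ t)) p<)
         (attached-≔-avoiding ind a< th u-avoids u-p) (attached-≔-avoiding ind a< th v-avoids v-p)

  -- x –a– y –q– z becomes x –q– z once D_a is exchanged for y.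
  bridge : Independent D → (x-y : Link D x y) (y-z : Link D y z) →
    Avoids D (Link.pos y-z) x → Avoids D (Link.pos x-y) z → Link (D [ Link.pos x-y ]≔ y) x z
  bridge {D} {x} {y} ind x-y@(link {a} a< x-a y-a) (link {q} q< y-q z-q) x-avoids z-avoids =
    link (subst (q <_) (sym (length-≔ D a y)) q<) x-q (attached-≔-avoiding ind a< (expansion y-a) z-avoids z-q)
    where
    open Attached using (coords; expands; uses)
    q≢a : q ≢ a
    q≢a refl = contradiction (trans (sym (uses z-q)) (z-avoids (expands z-q))) λ ()
    uses-q : rebase (coords y-a) a (coords x-a) q ≡ true
    uses-q rewrite rebase-other (coords y-a) (coords x-a) q≢a | x-avoids (expands x-a) | uses x-a
                 | through-unique ind q< (expansion y-q) (expands y-a) = refl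
    x-q : Attached (D [ a ]≔ y) q x
    x-q = attached (member x-a)
            (through (rebase (coords y-a) a (coords x-a))
                     (trans (lincomb-≔-rebase D (coords y-a) (coords x-a) a< (expands y-a) (uses y-a))
                            (expands x-a))
                     uses-q)
            (trans (link-weight x-y) (trans (balanced y-q) (cong w (sym (at-≔-other D y q≢a)))))

  record Detour (D : List (Subset n)) (a : ℕ) (z : Subset n) (bound : ℕ) : Set where
    constructor detour
    field
      {start}  : Subset n
      start-a  : Attached D a start
      rest     : Chain D start z
      rest≤    : chain-length rest ≤ bound

  reroute : Independent D → a < length D → Through D a t → S x → w x ≡ w (at D a) → lincomb D c ≡ x →
    (ch : Chain D x z) →
    Detour D a z (chain-length ch) ⊎
    (c a ≡ false × Σ[ ch′ ∈ Chain (D [ a ]≔ t) x z ] chain-length ch′ ≡ chain-length ch)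
  reroute {a = a} {c = c} ind a< th sx wx c≡x ch with c a in ca
  ... | true = inj₁ (detour (attached sx (through c c≡x ca) wx) ch ≤-refl)
  reroute ind a< th sx wx c≡x ε        | false = inj₂ (refl , ε , refl)
  reroute ind a< th sx wx c≡x (l ◅ ch) | false
    with reroute ind a< th (member (Link.right l)) (trans (sym (link-weight l)) wx)
                 (Attached.expands (Link.right l)) ch
  ... | inj₁ (detour s-a rest rest≤) = inj₁ (detour s-a rest (m≤n⇒m≤1+n rest≤))
  ... | inj₂ (c′a , ch′ , same)      =
    inj₂ ( refl
         , link-≔-avoiding ind a< th (avoids ind a< c≡x ca) (avoids ind a< (Attached.expands (Link.right l)) c′a) l ◅ ch′
         , cong suc same)

  collapse : ∀ fuel → IsMinBasis D → Link D x y → (ch : Chain D y z) → chain-length ch ≤ fuel →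
    ∃[ D′ ] IsMinBasis D′ × Link D′ x z
  collapse _ mD x-y ε _ = _ , mD , x-y
  collapse {D} {x} (suc fuel) mD x-y@(link {a} a< x-a y-a) (y-z@(link {q} q< y-q z-q) ◅ rest) (s≤s ≤fuel)
    with Attached.coords x-a q in xq
  ... | true = collapse fuel mD (link q< x-q z-q) rest ≤fuel
    where
    x-q : Attached D q x
    x-q = attached (member x-a) (through _ (Attached.expands x-a) xq) (trans (link-weight x-y) (balanced y-q))
  ... | false with reroute (independent (basis mD)) a< (expansion y-a) (member z-q)
                     (trans (sym (link-weight y-z)) (balanced y-a)) (Attached.expands z-q) rest
  ...   | inj₁ (detour v-a rest′ rest′≤) =
    collapse fuel mD (link a< x-a v-a) rest′ (≤-trans rest′≤ ≤fuel)
  ...   | inj₂ (za , rest′ , same)      =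
    collapse fuel (attached-≔-min mD a< y-a)
      (bridge ind x-y y-z (avoids ind q< (Attached.expands x-a) xq) (avoids ind a< (Attached.expands z-q) za))
      rest′ (subst (_≤ fuel) (sym same) ≤fuel)
    where
    ind : Independent D
    ind = independent (basis mD)

  module AfterExchange {A : List (Subset n)} {a : ℕ} {t : Subset n} (e : Exchange A a t) where

    private
      A′ : List (Subset n)
      A′ = A [ a ]≔ t
      t-a : Attached A a t
      t-a = exchange-attached e
      ct : ℕ → Bool
      ct = Attached.coords t-a

    rebase-uses : q < length A′ → Attached A′ q u → lincomb A c ≡ u → rebase ct a c q ≡ true
    rebase-uses {c = c} q<′ u-q c≡u = through-unique (independent (basis (after e))) q<′ (expansion u-q)
      (trans (lincomb-≔-rebase A ct c (pos< e) (Attached.expands t-a) (Attached.uses t-a)) c≡u)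

    attached-at-exchanged : Attached A′ a u → Attached A a u
    attached-at-exchanged u-a′ with spans (basis (before e)) (member u-a′)
    ... | c , c≡u = attached (member u-a′)
      (through c c≡u (trans (sym (rebase-at ct c (Attached.uses t-a)))
                            (rebase-uses (subst (a <_) (sym (length-≔ A a t)) (pos< e)) u-a′ c≡u)))
      (trans (balanced u-a′) (trans (cong w (at-≔-same A t (pos< e))) (balanced t-a)))

    -- Here A_a and A_q both have the weight of u, and either u –a– v or u –a– t –q– v.
    link⇒chain-half : (l : Link A′ u v) → Link.pos l ≢ a → lincomb A c ≡ u → c (Link.pos l) ≡ false →
      Chain A u v
    link⇒chain-half {u} {v} {c} l@(link {q} q<′ u-q v-q) q≢a c≡u cq =
      via (spans (basis (before e)) (member v-q))
      where
      q< : q < length A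
      q< = subst (q <_) (length-≔ A a t) q<′
      ca∧ctq : c a ∧ ct q ≡ true
      ca∧ctq = trans (cong (_xor (c a ∧ ct q)) (sym cq))
                     (trans (sym (rebase-other ct c q≢a)) (rebase-uses q<′ u-q c≡u))
      ca : c a ≡ true
      ca = ∧-conicalˡ (c a) (ct q) ca∧ctq
      ctq : ct q ≡ true
      ctq = ∧-conicalʳ (c a) (ct q) ca∧ctq
      u≈q : w u ≡ w (at A q)
      u≈q = trans (balanced u-q) (cong w (at-≔-other A t q≢a))
      u-a : Attached A a u
      u-a = attached (member u-q) (through c c≡u ca) (≤-antisym
        (begin
          w u         ≡⟨ u≈q ⟩
          w (at A q)  ≤⟨ min-through-≤ (before e) q< (member t-a) (through ct (Attached.expands t-a) ctq) ⟩
          w t         ≡⟨ balanced t-a ⟩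
          w (at A a)  ∎)
        (min-through-≤ (before e) (pos< e) (member u-q) (through c c≡u ca)))
        where open ≤-Reasoning
      t-q : Attached A q t
      t-q = attached (member t-a) (through ct (Attached.expands t-a) ctq)
                     (trans (balanced t-a) (trans (sym (balanced u-a)) u≈q))
      via : ∃[ cv ] lincomb A cv ≡ v → Chain A u v
      via (cv , cv≡v) with cv a in cva
      ... | true  = link (pos< e) u-a (attached (member v-q) (through cv cv≡v cva)
                                                (trans (sym (link-weight l)) (balanced u-a))) ◅ ε
      ... | false = link (pos< e) u-a t-a ◅ link q< t-q v-q′ ◅ ε
        where
        cvq : cv q ≡ true
        cvq = trans (sym (rebase-avoiding ct cv q cva)) (rebase-uses q<′ v-q cv≡v)
        v-q′ : Attached A q v
        v-q′ = attached (member v-q) (through cv cv≡v cvq)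
                        (trans (balanced v-q) (cong w (at-≔-other A t q≢a)))

    link⇒chain : Link A′ u v → Chain A u v
    link⇒chain {u} {v} l@(link {q} q<′ u-q v-q) with q ≟ a
    ... | yes refl = link (pos< e) (attached-at-exchanged u-q) (attached-at-exchanged v-q) ◅ ε
    ... | no q≢a   = via (spans (basis (before e)) (member u-q)) (spans (basis (before e)) (member v-q))
      where
      q< : q < length A
      q< = subst (q <_) (length-≔ A a t) q<′
      ≈q : Attached A′ q x → w x ≡ w (at A q)
      ≈q x-q = trans (balanced x-q) (cong w (at-≔-other A t q≢a))
      via : ∃[ cu ] lincomb A cu ≡ u → ∃[ cv ] lincomb A cv ≡ v → Chain A u v
      via (cu , cu≡u) (cv , cv≡v) with cu q in cuq | cv q in cvq
      ... | true  | true  = link q< (attached (member u-q) (through cu cu≡u cuq) (≈q u-q))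
                                    (attached (member v-q) (through cv cv≡v cvq) (≈q v-q)) ◅ ε
      ... | false | _     = link⇒chain-half l q≢a cu≡u cuq
      ... | true  | false = reverse link-sym (link⇒chain-half (link-sym l) q≢a cv≡v cvq)

  data Adjacent (A : List (Subset n)) : List (Subset n) → Set where
    adjacent : Exchange A p t → Adjacent A (A [ p ]≔ t)

  Connected : List (Subset n) → List (Subset n) → Set
  Connected A B = ∃[ C ] Star Adjacent A C × C ↭ B

  minBasis-⋆ : IsMinBasis A → Star Adjacent A C → IsMinBasis C
  minBasis-⋆ mA ε                  = mA
  minBasis-⋆ _  (adjacent e ◅ ees) = minBasis-⋆ (after e) ees

  private
    open module Dec = DecMembership {A = Subset n} (≡-dec Bool._≟_) using (_∈?_)

  misses : List (Subset n) → List (Subset n) → ℕ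
  misses B []      = 0
  misses B (x ∷ A) with x ∈? B
  ... | yes _ = misses B A
  ... | no  _ = suc (misses B A)

  misses≡0⇒⊆ : (A : List (Subset n)) → misses B A ≡ 0 → A ⊆ B
  misses≡0⇒⊆ {B} (x ∷ A) m≡0 y∈ with x ∈? B
  misses≡0⇒⊆ (x ∷ A) m≡0 (here refl) | yes x∈B = x∈B
  misses≡0⇒⊆ (x ∷ A) m≡0 (there y∈A) | yes _   = misses≡0⇒⊆ A m≡0 y∈A

  misses≡suc⇒∉ : (A : List (Subset n)) {k : ℕ} → misses B A ≡ suc k → ∃[ i ] i < length A × at A i ∉ B
  misses≡suc⇒∉ {B} (x ∷ A) m≡ with x ∈? B
  ... | no  x∉B = zero , z<s , x∉B
  ... | yes _ with misses≡suc⇒∉ {B} A m≡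
  ...   | i , i< , Ai∉B = suc i , s<s i< , Ai∉B

  misses-≔ : (A : List (Subset n)) → i < length A → at A i ∉ B → t ∈ B →
    misses B A ≡ suc (misses B (A [ i ]≔ t))
  misses-≔ {zero} {B} {t} (x ∷ A) _ x∉B t∈B with x ∈? B | t ∈? B
  ... | yes x∈B | _       = contradiction x∈B x∉B
  ... | no _    | yes _   = refl
  ... | no _    | no  t∉B = contradiction t∈B t∉B
  misses-≔ {suc i} {B} (x ∷ A) (s<s i<) Ai∉B t∈B with x ∈? B
  ... | yes _ = misses-≔ A i< Ai∉B t∈B
  ... | no  _ = cong suc (misses-≔ A i< Ai∉B t∈B)

  connect-misses : ∀ k → misses B A ≡ k → IsMinBasis A → IsMinBasis B → Connected A B
  connect-misses {B} {A} zero m≡0 mA mB =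
    A , ε , ∼bag⇒↭ (unique∧set⇒bag (independent⇒unique (independent (basis mA)))
                                   (independent⇒unique (independent (basis mB)))
                                   (mk⇔ A⊆B (basis-⊆⇒⊇ (basis mA) (basis mB) A⊆B)))
    where
    A⊆B : A ⊆ B
    A⊆B = misses≡0⇒⊆ A m≡0
  connect-misses {B} {A} (suc k) m≡ mA mB with misses≡suc⇒∉ A m≡
  ... | i , i< , Ai∉B with exchange-partner mA mB i<
  ...   | j , j< , e
    with connect-misses k (suc-injective (trans (sym (misses-≔ A i< Ai∉B (at-∈ B j<))) m≡)) (after e) mB
  ...     | C , ees , C↭B = C , adjacent e ◅ ees , C↭B

  connect : IsMinBasis A → IsMinBasis B → Connected A B
  connect mA mB = connect-misses _ refl mA mB

  -- Transitivity of interchangeability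

  chain-adjacent : Adjacent A B → Link A u v → Chain B u v
  chain-adjacent {A} (adjacent {p} {t} e) l =
    AfterExchange.link⇒chain (exchange-sym e) (subst (λ D → Link D _ _) (sym (≔-revert A p t)) l)

  chain-⋆ : Star Adjacent A C → Link A u v → Chain C u v
  chain-⋆ ε          l = l ◅ ε
  chain-⋆ (s ◅ ees)  l = (chain-⋆ ees ⋆) (chain-adjacent s l)

  link-↭ : IsBasis C → IsBasis B → C ↭ B → Link C u v → Link B u v
  link-↭ {C} {B} bC bB C↭B (link {p} p< u-p v-p) with ∈⇒at B (∈-resp-↭ C↭B (at-∈ C p<))
  ... | q , q< , Bq≡Cp = link q< (move u-p) (move v-p)
    where
    move : Attached C p x → Attached B q x
    move (attached sx th wx) =
      attached sx (through-⊆ bC bB (∈-resp-↭ (↭-sym C↭B)) p< q< (sym Bq≡Cp) sx th)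
                  (trans wx (cong w (sym Bq≡Cp)))

  chain-connected : IsMinBasis A → IsMinBasis B → Connected A B → Link A u v → Chain B u v
  chain-connected mA mB (C , ees , C↭B) =
    Star.map (link-↭ (basis (minBasis-⋆ mA ees)) (basis mB) C↭B) ∘ chain-⋆ ees

  link-trans : IsMinBasis A → IsMinBasis C → Link A x y → Link C y z → ∃[ D ] IsMinBasis D × Link D x z
  link-trans {A} {C} {x} {y} mA mC x-y y-z = map₂ (map₂ link-sym) (collapse _ mC (link-sym y-z) y⋯x ≤-refl)
    where
    y⋯x : Chain C y x
    y⋯x = chain-connected mA mC (connect mA mC) (link-sym x-y)

  interchangeable-trans : Interchangeable x y → Interchangeable y z → Interchangeable x z
  interchangeable-trans x∼y y∼z with interchangeable⇒link x∼y | interchangeable⇒link y∼z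
  ... | A , mA , x-y | C , mC , y-z with link-trans mA mC x-y y-z
  ...   | D , mD , x-z = link⇒interchangeable mD x-z

  module _ {P : Subset n → Set} (respects : ∀ {A p t} → Exchange A p t → P (at A p) ⇔ P t) where

    countIn-⋆ : {k : ℕ} → Star Adjacent A C → CountIn P A k → CountIn P C k
    countIn-⋆ ε                  = id
    countIn-⋆ (adjacent e ◅ ees) = countIn-⋆ ees ∘ countIn-≔ _ (pos< e) (respects e)

    countIn-connected : {k : ℕ} → Connected A B → CountIn P A k → CountIn P B k
    countIn-connected (C , ees , C↭B) = countIn-↭ C↭B ∘ countIn-⋆ ees

-- Cycle bases of a graph

module CycleSpace (G : Graph) where
  open MinimumBases (IsCycle G) ∣_∣ public

  private variable
    A M : List (EdgeSet G)
    p : ℕ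
    t x y z : EdgeSet G

  lookup≡at : (M : List (EdgeSet G)) (i : Fin (length M)) → lookup M i ≡ at M (toℕ i)
  lookup≡at (x ∷ M) fzero    = refl
  lookup≡at (x ∷ M) (fsuc i) = lookup≡at M i

  ∷=≡≔ : (M : List (EdgeSet G)) (i : Fin (length M)) (v : EdgeSet G) → M [ i ]∷= v ≡ M [ toℕ i ]≔ v
  ∷=≡≔ (x ∷ M) fzero    v = refl
  ∷=≡≔ (x ∷ M) (fsuc i) v = cong (x ∷_) (∷=≡≔ M i v)

  combo-toℕ : (M : List (EdgeSet G)) (c : ℕ → Bool) → combo G M (c ∘ toℕ) ≡ lincomb M c
  combo-toℕ []      c = refl
  combo-toℕ (x ∷ M) c with c 0
  ... | true  = cong (x ⊕_) (combo-toℕ M (c ∘ suc))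
  ... | false = trans (combo-toℕ M (c ∘ suc)) (sym (⊕-identityˡ _))

  extend : (M : List (EdgeSet G)) → (Fin (length M) → Bool) → ℕ → Bool
  extend []      c _       = false
  extend (x ∷ M) c zero    = c fzero
  extend (x ∷ M) c (suc k) = extend M (c ∘ fsuc) k

  extend-toℕ : (M : List (EdgeSet G)) (c : Fin (length M) → Bool) (i : Fin (length M)) →
    extend M c (toℕ i) ≡ c i
  extend-toℕ (x ∷ M) c fzero    = refl
  extend-toℕ (x ∷ M) c (fsuc i) = extend-toℕ M (c ∘ fsuc) i

  combo-extend : (M : List (EdgeSet G)) (c : Fin (length M) → Bool) → combo G M c ≡ lincomb M (extend M c)
  combo-extend []      c = refl
  combo-extend (x ∷ M) c with c fzero
  ... | true  = cong (x ⊕_) (combo-extend M (c ∘ fsuc))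
  ... | false = trans (combo-extend M (c ∘ fsuc)) (sym (⊕-identityˡ _))

  isCycleBasis⇒isBasis : IsCycleBasis G M → IsBasis M
  isCycleBasis⇒isBasis {M} (cycles , li , span) = record
    { members     = All.tabulate λ x∈M →
                      subst (IsCycle G) (sym (lookup-index x∈M)) (cycles (Any.index x∈M))
    ; independent = record { only-trivial = λ c c≡∅ {k} k< →
        trans (cong c (sym (toℕ-fromℕ< k<))) (li (c ∘ toℕ) (trans (combo-toℕ M c) c≡∅) (fromℕ< k<)) }
    ; spans       = λ cx → let c , c≡x = span _ cx in extend M c , trans (sym (combo-extend M c)) c≡x
    }

  isBasis⇒isCycleBasis : IsBasis M → IsCycleBasis G M
  isBasis⇒isCycleBasis {M} bM =
    (λ i → subst (IsCycle G) (sym (lookup≡at M i)) (All-at (members bM) (toℕ<n i))) ,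
    (λ c c≡∅ i → trans (sym (extend-toℕ M c i))
                   (only-trivial (independent bM) (extend M c) (trans (sym (combo-extend M c)) c≡∅) (toℕ<n i))) ,
    (λ C cC → let c , c≡C = spans bM cC in c ∘ toℕ , trans (combo-toℕ M c) c≡C)
    where open Independent

  isMCB⇒isMinBasis : IsMCB G M → IsMinBasis M
  isMCB⇒isMinBasis (bM , min) = record
    { basis = isCycleBasis⇒isBasis bM ; minimal = λ {M′} bM′ → min M′ (isBasis⇒isCycleBasis bM′) }

  isMinBasis⇒isMCB : IsMinBasis M → IsMCB G M
  isMinBasis⇒isMCB mM = isBasis⇒isCycleBasis (basis mM) , λ M′ bM′ → minimal mM (isCycleBasis⇒isBasis {M′} bM′)

  ∼pi⇒interchangeable : _∼pi_ G x y → Interchangeable x y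
  ∼pi⇒interchangeable {x} (M , i , mM , Mi≡y , mM′) = M , toℕ i , e , trans (sym (lookup≡at M i)) Mi≡y
    where
    e : Exchange M (toℕ i) x
    e = record
      { pos<   = toℕ<n i
      ; before = isMCB⇒isMinBasis mM
      ; after  = isMCB⇒isMinBasis (subst (IsMCB G) (∷=≡≔ M i x) mM′)
      }

  interchangeable⇒∼pi : Interchangeable x y → _∼pi_ G x y
  interchangeable⇒∼pi {x} (A , p , e , Ap≡y) =
    A , i , isMinBasis⇒isMCB (before e) , trans (lookup≡at A i) (trans (cong (at A) i≡p) Ap≡y) ,
    isMinBasis⇒isMCB (subst IsMinBasis (sym (trans (∷=≡≔ A i x) (cong (A [_]≔ x) i≡p))) (after e))
    where
    i : Fin (length A)
    i = fromℕ< (pos< e)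
    i≡p : toℕ i ≡ p
    i≡p = toℕ-fromℕ< (pos< e)

  ∼pi-trans : _∼pi_ G x y → _∼pi_ G y z → _∼pi_ G x z
  ∼pi-trans x∼y y∼z =
    interchangeable⇒∼pi (interchangeable-trans (∼pi⇒interchangeable x∼y) (∼pi⇒interchangeable y∼z))

  relevant-at : IsMinBasis A → p < length A → Relevant G (at A p)
  relevant-at {A} mA p< = A , isMinBasis⇒isMCB mA , at-∈ A p<

  piClass-∼pi-closed : {PI : EdgeSet G → Set} → IsPiClass G PI → Relevant G x → _∼pi_ G x y → PI y → PI x
  piClass-∼pi-closed {x} (C₀ , _ , PI⇔) rx x∼y PIy =
    proj₂ (PI⇔ x) (rx , ∼pi-trans x∼y (proj₂ (proj₁ (PI⇔ _) PIy)))

  piClass-respects-exchange : {PI : EdgeSet G → Set} → IsPiClass G PI → Exchange A p t → PI (at A p) ⇔ PI t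
  piClass-respects-exchange {A} {p} {t} isPI e = mk⇔
    (piClass-∼pi-closed isPI relevant-t                         (interchangeable⇒∼pi t∼Ap))
    (piClass-∼pi-closed isPI (relevant-at (before e) (pos< e)) (interchangeable⇒∼pi Ap∼t))
    where
    t∼Ap : Interchangeable t (at A p)
    t∼Ap = proj₁ (exchange-interchangeable e)
    Ap∼t : Interchangeable (at A p) t
    Ap∼t = proj₂ (exchange-interchangeable e)
    relevant-t : Relevant G t
    relevant-t = subst (Relevant G) (at-≔-same A t (pos< e))
                   (relevant-at (after e) (subst (p <_) (sym (length-≔ A p t)) (pos< e)))

corollary2 : (G : Graph) (M₁ M₂ : List (EdgeSet G)) (PI : EdgeSet G → Set) →
    IsMCB G M₁ → IsMCB G M₂ → IsPiClass G PI →
    (k₁ k₂ : ℕ) → CountIn PI M₁ k₁ → CountIn PI M₂ k₂ → k₁ ≡ k₂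
corollary2 G M₁ M₂ PI h₁ h₂ hPI k₁ k₂ c₁ c₂ = countIn-functional c₁′ c₂
  where
  open CycleSpace G
  c₁′ : CountIn PI M₂ k₁
  c₁′ = countIn-connected (piClass-respects-exchange hPI)
          (connect (isMCB⇒isMinBasis h₁) (isMCB⇒isMinBasis h₂)) c₁
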